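{- Let $\Gamma$ be a weakly distance-regular digraph and let $I$ be a nonempty subset of $T$. Suppose that $\Delta_I(x)$ is semicomplete for some vertex $x$. Then $\Delta_I(y)$ is a weakly distance-regular digraph for every vertex $y$, and $p_{\tilde i,\tilde j}^{\tilde h}(\Delta_I(x))=p_{\tilde i,\tilde j}^{\tilde h}(\Delta_I(y))$ for every vertex $y$ and all $\tilde i,\tilde j,\tilde h$.
   Context: Digraphs are finite with arcs being ordered pairs of distinct vertices. $\partial$ is the distance, $\tilde\partial(x,y)=(\partial(x,y),\partial(y,x))$, $\tilde\partial(\Gamma)$ its value set. Weakly distance-regular: strongly connected and for $\tilde h,\tilde i,\tilde j\in\tilde\partial(\Gamma)$ the number $p^{\tilde h}_{\tilde i,\tilde j}=p^{\tilde h}_{\tilde i,\tilde j}(\Gamma)$ of $z$ with $\tilde\partial(x,z)=\tilde i$, $\tilde\partial(z,y)=\tilde j$ depends only on $\tilde h=\tilde\partial(x,y)$. Semicomplete: any two distinct vertices joined by at least one arc. $\Gamma_{a,b}$ is the set of pairs with two-way distance $(a,b)$; $(a,b)^t=(b,a)$. An arc $(x,y)$ has type $(1,r)$ if $\partial(y,x)=r$; $T=\{q:(1,q-1)\in\tilde\partial(\Gamma)\}$. Let $R=\{\Gamma_{\tilde i}\}$; for nonempty $E,F\subseteq R$, $EF=\{\Gamma_{\tilde h}:\sum_E\sum_F p^{\tilde h}_{\tilde i,\tilde j}\neq0\}$; $F$ is closed if $\{\Gamma_{\tilde i^t}\}\{\Gamma_{\tilde j}\}\subseteq F$ for all $\Gamma_{\tilde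 i},\Gamma_{\tilde j}\in F$; $\langle F\rangle$ is the smallest closed set containing $F$; $F(x)=\{y:(x,y)\in\bigcup F\}$. $F_I=\langle\{\Gamma_{1,q-1}:q\in I\}\rangle$ and $\Delta_I(x)$ is the digraph with vertex set $F_I(x)$ and arc set $(\bigcup_{q\in I}\Gamma_{1,q-1})\cap(F_I(x)\times F_I(x))$. -}

module Defs where

open import Data.Nat using (ℕ; zero; suc; _<_; _∸_)
open import Data.Fin using (Fin)
open import Data.Bool using (Bool; true; false)
open import Data.Unit using (⊤)
open import Data.Product using (Σ; ∃; ∃-syntax; _×_; _,_; proj₁; proj₂; swap)
open import Data.Sum using (_⊎_)
open import Data.List using (List; length)
open import Data.List.Membership.Propositional using (_∈_)
open import Data.List.Relation.Unary.Unique.Propositional using (Unique)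
open import Relation.Binary.PropositionalEquality using (_≡_; _≢_)
open import Relation.Nullary using (¬_)

-- A digraph whose vertices form a subset (predicate Vtx) of Fin n,
-- with arc relation Arc.  The ambient Γ has Vtx = everything; the
-- subdigraphs Δ_I(x) have Vtx = F_I(x).
record Digraph (n : ℕ) : Set₁ where
  field
    Vtx : Fin n → Set
    Arc : Fin n → Fin n → Set

module _ {n : ℕ} (G : Digraph n) where
  open Digraph G

  data Walk : Fin n → Fin n → ℕ → Set where
    here : ∀ {x} → Vtx x → Walk x x zero
    step : ∀ {x z y k} → Vtx x → Arc x z → Walk z y k → Walk x y (suc k)

  Dist : Fin n → Fin n → ℕ → Set
  Dist x y d = Walk x y d × (∀ k → k < d → ¬ Walk x y k)

  TwoWay : Fin n → Fin n → ℕ × ℕ → Set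
  TwoWay x y h = Dist x y (proj₁ h) × Dist y x (proj₂ h)

  StronglyConnected : Set
  StronglyConnected = ∀ x y → Vtx x → Vtx y → ∃[ k ] Walk x y k

  InVals : ℕ × ℕ → Set
  InVals h = ∃[ x ] ∃[ y ] TwoWay x y h

  Count : (Fin n → Set) → ℕ → Set
  Count P m = Σ (List (Fin n)) λ l →
    Unique l × length l ≡ m ×
    (∀ z → (z ∈ l → Vtx z × P z) × (Vtx z × P z → z ∈ l))

  Num : Fin n → Fin n → ℕ × ℕ → ℕ × ℕ → ℕ → Set
  Num x y i j m = Count (λ z → TwoWay x z i × TwoWay z y j) m

  WDR : Set
  WDR = StronglyConnected ×
    (∀ h i j → InVals h → InVals i → InVals j →
      ∃[ p ] (∀ x y → TwoWay x y h → Num x y i j p))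

  Semicomplete : Set
  Semicomplete = ∀ u v → Vtx u → Vtx v → u ≢ v → Arc u v ⊎ Arc v u

  -- Γ_h ∈ {Γ_i}{Γ_j}, i.e. h ∈ ∂̃(G) and p^h_{i,j} ≠ 0
  Comp : ℕ × ℕ → ℕ × ℕ → ℕ × ℕ → Set
  Comp i j h = InVals h ×
    (∃[ x ] ∃[ y ] ∃[ z ] TwoWay x y h × TwoWay x z i × TwoWay z y j)

  data Closure (F : ℕ × ℕ → Set) : ℕ × ℕ → Set where
    gen  : ∀ {h} → F h → Closure F h
    comp : ∀ {i j h} → Closure F i → Closure F j → Comp (swap i) j h → Closure F h

SameParams : ∀ {n} → Digraph n → Digraph n → Set
SameParams G H = ∀ h i j x y u v → TwoWay G x y h → TwoWay H u v h →
  ∀ m m' → Num G x y i j m → Num H u v i j m' → m ≡ m'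

Γd : ∀ {n} → (Fin n → Fin n → Bool) → Digraph n
Γd A = record { Vtx = λ _ → ⊤ ; Arc = λ x y → A x y ≡ true }

InT : ∀ {n} → (Fin n → Fin n → Bool) → ℕ → Set
InT A q = InVals (Γd A) (1 , q ∸ 1)

FI : ∀ {n} → (Fin n → Fin n → Bool) → (ℕ → Set) → ℕ × ℕ → Set
FI A I = Closure (Γd A) (λ h → ∃[ q ] I q × h ≡ (1 , q ∸ 1))

FIx : ∀ {n} → (Fin n → Fin n → Bool) → (ℕ → Set) → Fin n → Fin n → Set
FIx A I x y = ∃[ h ] FI A I h × TwoWay (Γd A) x y h

Δ : ∀ {n} → (Fin n → Fin n → Bool) → (ℕ → Set) → Fin n → Digraph n
Δ A I x = record
  { Vtx = FIx A I x
  ; Arc = λ u v → FIx A I x u × FIx A I x v ×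
                  (∃[ q ] I q × TwoWay (Γd A) u v (1 , q ∸ 1))
  }

{-# OPTIONS --safe #-}
-- By weak distance-regularity the number of vertices z with ∂̃(a, z) = t does not depend on a, so
-- every decidable set of types has the same "out-degree" at all vertices. Closedness of F_I makes
-- "y ∈ F_I(x)" an equivalence relation, and semicompleteness of Δ_I(x) spreads to every class,
-- because each pair in a class has the type of some pair (x, z). Inside a class, an I-arc v → u
-- lies on a directed triangle v → u → z → v: otherwise the out-neighbours of u would be
-- out-neighbours of v, and u is one more. Hence I-arcs inside a class have type (1,1) or (1,2),
-- every Γ-distance between vertices of F_I(y) is realised in Δ_I(y), and the intersection numbers
-- of Δ_I(y) are those of Γ for the types in F_I, whatever y is.
module Submission where

open import Defs
open import Data.Bool using (Bool; true; false)
import Data.Bool as Bool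
open import Data.Fin using (Fin; zero; suc)
open import Data.Fin.Properties using (any?) renaming (_≟_ to _≟ᶠ_)
open import Data.List using (List; []; _∷_; _++_; length; filter; allFin)
open import Data.List.Membership.Propositional using (_∈_; lose)
open import Data.List.Membership.Propositional.Properties
  using (∈-allFin; ∈-filter⁺; ∈-filter⁻; ∈-++⁺ˡ; ∈-++⁺ʳ; ∈-++⁻)
open import Data.List.Membership.Propositional.Properties.WithK using (unique∧set⇒bag)
open import Data.List.Properties using (length-++; filter-notAll; filter-some)
open import Data.List.Relation.Binary.BagAndSetEquality using (∼bag⇒↭)
open import Data.List.Relation.Binary.Permutation.Propositional.Properties using (↭-length)
import Data.List.Relation.Unary.AllPairs as AllPairs
open import Data.List.Relation.Unary.Any using (here)
open import Data.List.Relation.Unary.Unique.Propositional using (Unique)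
open import Data.List.Relation.Unary.Unique.Propositional.Properties using (allFin⁺; filter⁺; ++⁺)
open import Data.Nat using (ℕ; zero; suc; _+_; _<_; _≤_; _∸_; z≤n; s≤s; _≟_; _≤?_; _<?_)
open import Data.Nat.Induction using (<-wellFounded)
open import Data.Nat.Properties
  using (<-cmp; <⇒≢; <-≤-trans; <-trans; ≤-trans; ≤-reflexive; ≮⇒≥; m≤m+n; m≤n+m; m<1+n⇒m<n∨m≡n; anyUpTo?;
         module ≤-Reasoning)
open import Data.Product using (∃; ∃-syntax; _×_; _,_; proj₁; proj₂; swap)
open import Data.Product.Properties using (≡-dec)
open import Data.Sum using (_⊎_; inj₁; inj₂; [_,_]′)
import Data.Sum as Sum
open import Data.Unit using (⊤; tt)
open import Function using (_∘_; _∘′_; id; flip)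
open import Function.Bundles using (_⇔_; mk⇔; Equivalence)
open import Induction.WellFounded using (Acc; acc)
open import Relation.Binary.Definitions using (DecidableEquality; tri<; tri≈; tri>)
open import Relation.Binary.PropositionalEquality
  using (_≡_; _≢_; refl; sym; trans; cong; cong₂; subst; module ≡-Reasoning)
open import Relation.Nullary using (¬_; Dec; yes; no; contradiction)
open import Relation.Nullary.Decidable using (decidable-stable; ¬¬-excluded-middle; _×-dec_; _⊎-dec_; ¬?)
import Relation.Nullary.Decidable as Dec
open import Relation.Unary using (Decidable)
open import Relation.Unary.Properties using (_∩?_; ∁?)

same-members⇒length≡ : ∀ {A : Set} {xs ys : List A} → Unique xs → Unique ys →
                       (∀ {z} → z ∈ xs → z ∈ ys) → (∀ {z} → z ∈ ys → z ∈ xs) → length xs ≡ length ys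
same-members⇒length≡ u u′ xs⊆ys ys⊆xs = ↭-length (∼bag⇒↭ (unique∧set⇒bag u u′ (mk⇔ xs⊆ys ys⊆xs)))

minimal-witness : ∀ {P : ℕ → Set} → Decidable P → ∀ {k} → P k → ∃[ d ] (P d × (∀ m → m < d → ¬ P m))
minimal-witness {P} P? {k} = go k (<-wellFounded k)
  where
  go : ∀ k → Acc _<_ k → P k → ∃[ d ] (P d × (∀ m → m < d → ¬ P m))
  go k (acc rs) pk with anyUpTo? P? k
  ... | yes (m , m<k , pm) = go m (rs m<k) pm
  ... | no ∄               = k , pk , λ m m<k pm → ∄ (m , m<k , pm)

¬¬-decidable-below : ∀ {P : ℕ → Set} N → ¬ ¬ (∀ m → m < N → Dec (P m))
¬¬-decidable-below zero    k = k λ _ ()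
¬¬-decidable-below (suc N) k = ¬¬-decidable-below N λ dec< → ¬¬-excluded-middle λ decN →
  k λ m m<1+N → [ dec< m , (λ { refl → decN }) ]′ (m<1+n⇒m<n∨m≡n m<1+N)

Fin-bounded : ∀ {n} (f : Fin n → ℕ) → ∃[ N ] (∀ i → f i < N)
Fin-bounded {zero}  f = 0 , λ ()
Fin-bounded {suc n} f with Fin-bounded (f ∘ suc)
... | N , bound = suc (f zero) + N , λ { zero    → s≤s (m≤m+n _ N)
                                       ; (suc i) → <-≤-trans (bound i) (m≤n+m N _) }

Fin-bounded₂ : ∀ {n} (f : Fin n → Fin n → ℕ) → ∃[ N ] (∀ i j → f i j < N)
Fin-bounded₂ f with Fin-bounded (λ i → proj₁ (Fin-bounded (f i)))
... | N , bound = N , λ i j → <-trans (proj₂ (Fin-bounded (f i)) j) (bound i)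

module _ {n : ℕ} {G : Digraph n} where
  open Digraph G

  walk₀⇒≡ : ∀ {x y} → Walk G x y 0 → x ≡ y
  walk₀⇒≡ (here _) = refl

  walk-endpoints : ∀ {x y k} → Walk G x y k → Vtx x × Vtx y
  walk-endpoints (here v)     = v , v
  walk-endpoints (step v _ w) = v , proj₂ (walk-endpoints w)

  walk-++ : ∀ {x y z k l} → Walk G x y k → Walk G y z l → Walk G x z (k + l)
  walk-++ (here _)       w′ = w′
  walk-++ (step vx xa w) w′ = step vx xa (walk-++ w w′)

  Dist-functional : ∀ {x y d d′} → Dist G x y d → Dist G x y d′ → d ≡ d′
  Dist-functional {d = d} {d′} (w , min) (w′ , min′) with <-cmp d d′
  ... | tri< d<d′ _ _ = contradiction w (min′ d d<d′)
  ... | tri≈ _ d≡d′ _ = d≡d′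
  ... | tri> _ _ d>d′ = contradiction w′ (min d′ d>d′)

  TwoWay-functional : ∀ {x y h h′} → TwoWay G x y h → TwoWay G x y h′ → h ≡ h′
  TwoWay-functional (d₁ , d₂) (d₁′ , d₂′) = cong₂ _,_ (Dist-functional d₁ d₁′) (Dist-functional d₂ d₂′)

  Count-map : ∀ {H : Digraph n} {P P′ : Fin n → Set} {m} →
              (∀ {z} → Vtx z × P z → Digraph.Vtx H z × P′ z) →
              (∀ {z} → Digraph.Vtx H z × P′ z → Vtx z × P z) →
              Count G P m → Count H P′ m
  Count-map f g (l , u , len , mem) = l , u , len , λ z → f ∘′ proj₁ (mem z) , proj₂ (mem z) ∘′ g

  Count-functional : ∀ {P : Fin n → Set} {m m′} → Count G P m → Count G P m′ → m ≡ m′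
  Count-functional {m = m} {m′} (l , u , len , mem) (l′ , u′ , len′ , mem′) = begin
    m         ≡⟨ sym len ⟩
    length l  ≡⟨ same-members⇒length≡ u u′ (proj₂ (mem′ _) ∘ proj₁ (mem _)) (proj₂ (mem _) ∘ proj₁ (mem′ _)) ⟩
    length l′ ≡⟨ len′ ⟩
    m′        ∎
    where open ≡-Reasoning

  Count-witness : ∀ {P : Fin n → Set} {m} → Count G P (suc m) → ∃[ z ] (Vtx z × P z)
  Count-witness ([]    , _ , () , _)
  Count-witness (z ∷ _ , _ , _  , mem) = z , proj₁ (mem z) (here refl)

  Count-nonzero : ∀ {P : Fin n → Set} {z} → Vtx z → P z → ¬ Count G P 0
  Count-nonzero vz pz ([] , _ , _ , mem) with proj₂ (mem _) (vz , pz)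
  ... | ()

module _ {n : ℕ} where

  count : {P : Fin n → Set} → Decidable P → ℕ
  count P? = length (filter P? (allFin n))

  count-list : ∀ {P : Fin n → Set} (P? : Decidable P) {l} → Unique l →
               (∀ {z} → z ∈ l → P z) → (∀ {z} → P z → z ∈ l) → length l ≡ count P?
  count-list P? u sound complete = same-members⇒length≡ u (filter⁺ P? (allFin⁺ n))
    (∈-filter⁺ P? (∈-allFin _) ∘ sound) (complete ∘ proj₂ ∘ ∈-filter⁻ P? {xs = allFin n})

  Count⇒≡count : ∀ {G : Digraph n} {P R : Fin n → Set} {m} (R? : Decidable R) →
                 (∀ {z} → Digraph.Vtx G z × P z → R z) → (∀ {z} → R z → Digraph.Vtx G z × P z) →
                 Count G P m → m ≡ count R?
  Count⇒≡count R? sound complete (l , u , len , mem) =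
    trans (sym len) (count-list R? u (sound ∘ proj₁ (mem _)) (proj₂ (mem _) ∘ complete))

  count-cong : ∀ {P R : Fin n → Set} (P? : Decidable P) (R? : Decidable R) →
               (∀ {z} → P z → R z) → (∀ {z} → R z → P z) → count P? ≡ count R?
  count-cong P? R? P⇒R R⇒P = count-list R? (filter⁺ P? (allFin⁺ n))
    (P⇒R ∘ proj₂ ∘ ∈-filter⁻ P? {xs = allFin n}) (∈-filter⁺ P? (∈-allFin _) ∘ R⇒P)

  count-zero : ∀ {P : Fin n → Set} (P? : Decidable P) → (∀ z → ¬ P z) → count P? ≡ 0
  count-zero P? ∄P = sym (count-list P? {l = []} AllPairs.[] (λ ()) (λ {z} pz → contradiction pz (∄P z)))

  count-pos : ∀ {P : Fin n → Set} (P? : Decidable P) {z} → P z → 0 < count P?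
  count-pos P? pz = filter-some P? (lose (∈-allFin _) pz)

  count-split : ∀ {P R : Fin n → Set} (P? : Decidable P) (R? : Decidable R) →
                count P? ≡ count (P? ∩? ∁? R?) + count (P? ∩? R?)
  count-split {P} P? R? = begin
    count P?                               ≡⟨ sym (count-list P? unique sound complete) ⟩
    length (without ++ within)             ≡⟨ length-++ without ⟩
    count (P? ∩? ∁? R?) + count (P? ∩? R?) ∎
    where
    open ≡-Reasoning
    without = filter (P? ∩? ∁? R?) (allFin n)
    within  = filter (P? ∩? R?) (allFin n)
    unique : Unique (without ++ within)
    unique = ++⁺ (filter⁺ _ (allFin⁺ n)) (filter⁺ _ (allFin⁺ n)) λ (z∈without , z∈within) →
      proj₂ (proj₂ (∈-filter⁻ _ {xs = allFin n} z∈without)) (proj₂ (proj₂ (∈-filter⁻ _ {xs = allFin n} z∈within)))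
    sound : ∀ {z} → z ∈ without ++ within → P z
    sound z∈ = [ proj₁ ∘ proj₂ ∘ ∈-filter⁻ _ {xs = allFin n} , proj₁ ∘ proj₂ ∘ ∈-filter⁻ _ {xs = allFin n} ]′
                 (∈-++⁻ without z∈)
    complete : ∀ {z} → P z → z ∈ without ++ within
    complete {z} pz with R? z
    ... | yes rz = ∈-++⁺ʳ without (∈-filter⁺ _ (∈-allFin z) (pz , rz))
    ... | no ¬rz = ∈-++⁺ˡ (∈-filter⁺ _ (∈-allFin z) (pz , ¬rz))

  count-< : ∀ {P R : Fin n → Set} (P? : Decidable P) (R? : Decidable R) →
            (∀ {z} → P z → R z) → ∀ {w} → R w → ¬ P w → count P? < count R?
  count-< {P} P? R? P⇒R {w} rw ¬pw = begin-strict
    count P?                                  ≡⟨ sym (count-list P? (filter⁺ P? (filter⁺ R? (allFin⁺ n))) sound complete) ⟩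
    length (filter P? (filter R? (allFin n))) <⟨ filter-notAll P? _ (lose (∈-filter⁺ R? (∈-allFin w) rw) ¬pw) ⟩
    count R?                                  ∎
    where
    open ≤-Reasoning
    sound : ∀ {z} → z ∈ filter P? (filter R? (allFin n)) → P z
    sound = proj₂ ∘ ∈-filter⁻ P? {xs = filter R? (allFin n)}
    complete : ∀ {z} → P z → z ∈ filter P? (filter R? (allFin n))
    complete pz = ∈-filter⁺ P? (∈-filter⁺ R? (∈-allFin _) (P⇒R pz)) pz

  outdegree≡⇒2-path : ∀ {P : Fin n → Fin n → Set} (P? : ∀ a → Decidable (P a)) {a b} →
                      count (P? a) ≡ count (P? b) → P b a → ¬ P a a →
                      (∀ {z} → P a z → ¬ P z b → ¬ ¬ P b z) → ∃[ z ] (P a z × P z b)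
  outdegree≡⇒2-path {P} P? {a} {b} deg≡ pba ¬paa escape with any? (λ z → P? a z ×-dec P? z b)
  ... | yes path = path
  ... | no ∄path = contradiction deg≡ (<⇒≢ (count-< (P? a) (P? b) out-a⊆out-b pba ¬paa))
    where
    out-a⊆out-b : ∀ {z} → P a z → P b z
    out-a⊆out-b {z} paz = decidable-stable (P? b z) (escape paz (λ pzb → ∄path (z , paz , pzb)))

  module _ {B : Set} (_≟_ : DecidableEquality B) (f g : Fin n → B)
           (fibres≡ : ∀ t → count (λ z → f z ≟ t) ≡ count (λ z → g z ≟ t)) where

    count-preimage≡ : {φ : B → Set} (φ? : Decidable φ) → count (φ? ∘ f) ≡ count (φ? ∘ g)
    count-preimage≡ φ? = go φ? (<-wellFounded _)
      where
      fibre : ∀ {φ : B → Set} (φ? : Decidable φ) (h : Fin n → B) {t} → φ t →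
              count ((φ? ∘ h) ∩? (λ z → h z ≟ t)) ≡ count (λ z → h z ≟ t)
      fibre φ? h φt = count-cong _ _ proj₂ (λ { refl → φt , refl })

      go : ∀ {φ : B → Set} (φ? : Decidable φ) → Acc _<_ (count (φ? ∘ f)) → count (φ? ∘ f) ≡ count (φ? ∘ g)
      go {φ} φ? (acc rs) with any? (φ? ∘ f)
      ... | no ∄f = trans (count-zero _ λ z φfz → ∄f (z , φfz)) (sym (count-zero _ ∄g))
        where
        ∄g : ∀ z → ¬ φ (g z)
        ∄g z φgz = <⇒≢ (count-pos (λ w → g w ≟ g z) refl) (begin
          0                       ≡⟨ sym (count-zero _ λ w fw≡gz → ∄f (w , subst φ (sym fw≡gz) φgz)) ⟩
          count (λ w → f w ≟ g z) ≡⟨ fibres≡ (g z) ⟩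
          count (λ w → g w ≟ g z) ∎)
          where open ≡-Reasoning
      ... | yes (z₀ , φfz₀) = begin
        count (φ? ∘ f)                                        ≡⟨ count-split (φ? ∘ f) (λ z → f z ≟ t) ⟩
        count (φ′? ∘ f) + count ((φ? ∘ f) ∩? (λ z → f z ≟ t)) ≡⟨ cong₂ _+_ (go φ′? (rs smaller)) (fibre φ? f φfz₀) ⟩
        count (φ′? ∘ g) + count (λ z → f z ≟ t)               ≡⟨ cong (count (φ′? ∘ g) +_) (fibres≡ t) ⟩
        count (φ′? ∘ g) + count (λ z → g z ≟ t)               ≡⟨ cong (count (φ′? ∘ g) +_) (sym (fibre φ? g φfz₀)) ⟩
        count (φ′? ∘ g) + count ((φ? ∘ g) ∩? (λ z → g z ≟ t)) ≡⟨ sym (count-split (φ? ∘ g) (λ z → g z ≟ t)) ⟩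
        count (φ? ∘ g)                                        ∎
        where
        open ≡-Reasoning
        t = f z₀
        φ′? : Decidable (λ s → φ s × ¬ s ≡ t)
        φ′? = φ? ∩? ∁? (_≟ t)
        smaller : count (φ′? ∘ f) < count (φ? ∘ f)
        smaller = count-< (φ′? ∘ f) (φ? ∘ f) proj₁ φfz₀ (λ (_ , fz₀≢t) → fz₀≢t refl)

_≟²_ : DecidableEquality (ℕ × ℕ)
_≟²_ = ≡-dec _≟_ _≟_

ShortArcType : ℕ × ℕ → Set
ShortArcType t = t ≡ (1 , 1) ⊎ t ≡ (1 , 2)

ShortArcType? : Decidable ShortArcType
ShortArcType? t = (t ≟² (1 , 1)) ⊎-dec (t ≟² (1 , 2))

¬ShortArcType-2,1 : ∀ {t} → t ≡ (2 , 1) → ¬ ShortArcType t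
¬ShortArcType-2,1 refl (inj₁ ())
¬ShortArcType-2,1 refl (inj₂ ())

CycleType : ℕ × ℕ → Set
CycleType t = t ≡ (0 , 0) ⊎ t ≡ (1 , 2) ⊎ t ≡ (2 , 1)

CycleType? : Decidable CycleType
CycleType? t = (t ≟² (0 , 0)) ⊎-dec (t ≟² (1 , 2)) ⊎-dec (t ≟² (2 , 1))

module WeaklyDistanceRegular {n : ℕ} (A : Fin n → Fin n → Bool) (wdr : WDR (Γd A)) where

  Γ : Digraph n
  Γ = Γd A

  walk? : ∀ x y k → Dec (Walk Γ x y k)
  walk? x y zero with x ≟ᶠ y
  ... | yes refl = yes (here tt)
  ... | no x≢y   = no (x≢y ∘ walk₀⇒≡)
  walk? x y (suc k) with any? (λ z → (A x z Bool.≟ true) ×-dec walk? z y k)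
  ... | yes (z , xz , w) = yes (step tt xz w)
  ... | no ∄             = no λ { (step {z = z} _ xz w) → ∄ (z , xz , w) }

  opaque
    distance : ∀ x y → ∃ (Dist Γ x y)
    distance x y = minimal-witness (walk? x y) (proj₂ (proj₁ wdr x y tt tt))

  δ : Fin n → Fin n → ℕ
  δ x y = proj₁ (distance x y)

  τ : Fin n → Fin n → ℕ × ℕ
  τ x y = δ x y , δ y x

  τ-TwoWay : ∀ x y → TwoWay Γ x y (τ x y)
  τ-TwoWay x y = proj₂ (distance x y) , proj₂ (distance y x)

  TwoWay⇒≡τ : ∀ {x y h} → TwoWay Γ x y h → h ≡ τ x y
  TwoWay⇒≡τ tw = TwoWay-functional tw (τ-TwoWay _ _)

  ≡τ⇒TwoWay : ∀ {x y h} → h ≡ τ x y → TwoWay Γ x y h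
  ≡τ⇒TwoWay {x} {y} refl = τ-TwoWay x y

  TwoWay-refl : ∀ x → TwoWay Γ x x (0 , 0)
  TwoWay-refl x = dist₀ , dist₀
    where dist₀ = here tt , λ _ ()

  τ-refl : ∀ x → τ x x ≡ (0 , 0)
  τ-refl x = sym (TwoWay⇒≡τ (TwoWay-refl x))

  δ≡0⇒≡ : ∀ {x y} → δ x y ≡ 0 → x ≡ y
  δ≡0⇒≡ {x} {y} δ≡0 = walk₀⇒≡ (subst (Walk Γ x y) δ≡0 (proj₁ (proj₂ (distance x y))))

  τ≢1,0 : ∀ x y → τ x y ≢ (1 , 0)
  τ≢1,0 x y τxy≡1,0 with δ≡0⇒≡ {y} {x} (cong proj₂ τxy≡1,0)
  ... | refl with trans (sym (cong proj₁ τxy≡1,0)) (cong proj₂ τxy≡1,0)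
  ...   | ()

  δ-triangle : ∀ x y z → δ x z ≤ δ x y + δ y z
  δ-triangle x y z = ≮⇒≥ λ shorter → proj₂ (proj₂ (distance x z)) _ shorter
    (walk-++ (proj₁ (proj₂ (distance x y))) (proj₁ (proj₂ (distance y z))))

  valency : ∀ a z → ∃[ k ] (∀ c → Num Γ c c (τ a z) (τ z a) k)
  valency a z
    with proj₂ wdr (0 , 0) (τ a z) (τ z a) (a , a , TwoWay-refl a) (a , z , τ-TwoWay a z) (z , a , τ-TwoWay z a)
  ... | k , num = k , λ c → num c c (TwoWay-refl c)

  τ-transfer : ∀ a b z → ∃[ z′ ] (τ b z′ ≡ τ a z)
  τ-transfer a b z with valency a z
  ... | zero  , num = contradiction (num a) (Count-nonzero {G = Γ} {z = z} tt (τ-TwoWay a z , τ-TwoWay z a))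
  ... | suc _ , num with Count-witness {G = Γ} (num b)
  ...   | z′ , _ , bz′ , _ = z′ , sym (TwoWay⇒≡τ bz′)

  valency≡count : ∀ a z c → proj₁ (valency a z) ≡ count (λ w → τ c w ≟² τ a z)
  valency≡count a z c = Count⇒≡count {G = Γ} _ (λ (_ , cw , _) → sym (TwoWay⇒≡τ cw))
    (λ τcw≡ → tt , ≡τ⇒TwoWay (sym τcw≡) , ≡τ⇒TwoWay (sym (cong swap τcw≡))) (proj₂ (valency a z) c)

  valency≡ : ∀ a b t → count (λ z → τ a z ≟² t) ≡ count (λ z → τ b z ≟² t)
  valency≡ a b t with any? (λ z → τ a z ≟² t)
  ... | yes (z , refl) = trans (sym (valency≡count a z a)) (valency≡count a z b)
  ... | no ∄ = trans (count-zero _ λ z τaz≡t → ∄ (z , τaz≡t)) (sym (count-zero _ ∄b))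
    where
    ∄b : ∀ z → ¬ τ b z ≡ t
    ∄b z τbz≡t with τ-transfer b a z
    ... | z′ , τaz′≡τbz = ∄ (z′ , trans τaz′≡τbz τbz≡t)

  count-τ≡ : ∀ {φ : ℕ × ℕ → Set} (φ? : Decidable φ) a b → count (φ? ∘ τ a) ≡ count (φ? ∘ τ b)
  count-τ≡ φ? a b = count-preimage≡ _≟²_ (τ a) (τ b) (valency≡ a b) φ?

  τ-2-path : ∀ {φ : ℕ × ℕ → Set} (φ? : Decidable φ) {u v} → φ (τ v u) → ¬ φ (0 , 0) →
             (∀ {z} → φ (τ u z) → ¬ φ (τ z v) → ¬ ¬ φ (τ v z)) → ∃[ z ] (φ (τ u z) × φ (τ z v))
  τ-2-path {φ} φ? {u} φvu ¬φ₀₀ =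
    outdegree≡⇒2-path (λ a → φ? ∘ τ a) (count-τ≡ φ? _ _) φvu (¬φ₀₀ ∘ subst φ (τ-refl u))

  CycleTypes-closed : Set
  CycleTypes-closed = ∀ c a b → CycleType (τ c a) → CycleType (τ c b) → CycleType (τ a b)

  2-path-if-closed : CycleTypes-closed → ∀ {u v} → τ v u ≡ (1 , 2) →
                     ∃[ z ] (τ u z ≡ (1 , 2) × τ z v ≡ (1 , 2))
  2-path-if-closed closed {u} {v} τvu≡1,2 = τ-2-path (_≟² (1 , 2)) τvu≡1,2 (λ ()) escape
    where
    escape : ∀ {z} → τ u z ≡ (1 , 2) → τ z v ≢ (1 , 2) → ¬ ¬ τ v z ≡ (1 , 2)
    escape {z} τuz≡1,2 τzv≢1,2 ¬τvz≡1,2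
      with closed u z v (inj₂ (inj₁ τuz≡1,2)) (inj₂ (inj₂ (cong swap τvu≡1,2)))
    ... | inj₂ (inj₁ τzv≡1,2) = τzv≢1,2 τzv≡1,2
    ... | inj₂ (inj₂ τzv≡2,1) = ¬τvz≡1,2 (cong swap τzv≡2,1)
    ... | inj₁ τzv≡0,0 with δ≡0⇒≡ (cong proj₁ τzv≡0,0)
    ...   | refl with trans (sym τuz≡1,2) (cong swap τvu≡1,2)
    ...     | ()

  module Classes (I : ℕ → Set) {q₀} (q₀∈I : I q₀) (I⊆T : ∀ q → I q → InT A q) where

    F : ℕ × ℕ → Set
    F = FI A I

    infix 4 _∼_
    _∼_ : Fin n → Fin n → Set
    x ∼ y = F (τ x y)

    ∼-comp : ∀ {x y z} → y ∼ x → y ∼ z → x ∼ z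
    ∼-comp {x} {y} {z} y∼x y∼z =
      comp y∼x y∼z ((x , z , τ-TwoWay x z) , x , z , y , τ-TwoWay x z , τ-TwoWay x y , τ-TwoWay y z)

    F-zero : F (0 , 0)
    F-zero with I⊆T q₀ q₀∈I
    ... | a , b , tw = subst F (τ-refl b) (∼-comp a∼b a∼b)
      where
      a∼b : a ∼ b
      a∼b = subst F (TwoWay⇒≡τ tw) (gen (q₀ , q₀∈I , refl))

    ∼-refl : ∀ x → x ∼ x
    ∼-refl x = subst F (sym (τ-refl x)) F-zero

    ∼-sym : ∀ {x y} → x ∼ y → y ∼ x
    ∼-sym {x} x∼y = ∼-comp x∼y (∼-refl x)

    ∼-trans : ∀ {x y z} → x ∼ y → y ∼ z → x ∼ z
    ∼-trans x∼y = ∼-comp (∼-sym x∼y)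

    FIx⇒∼ : ∀ {x y} → FIx A I x y → x ∼ y
    FIx⇒∼ (_ , fh , tw) = subst F (TwoWay⇒≡τ tw) fh

    ∼⇒FIx : ∀ {x y} → x ∼ y → FIx A I x y
    ∼⇒FIx {x} {y} x∼y = τ x y , x∼y , τ-TwoWay x y

    IArcType : ℕ × ℕ → Set
    IArcType (d , e) = d ≡ 1 × I (suc e)

    IArc : Fin n → Fin n → Set
    IArc u v = ∃[ q ] (I q × TwoWay Γ u v (1 , q ∸ 1))

    IArc⇒IArcType : ∀ {u v} → IArc u v → IArcType (τ u v)
    IArc⇒IArcType {u} {v} (zero  , _   , tw) = contradiction (sym (TwoWay⇒≡τ tw)) (τ≢1,0 u v)
    IArc⇒IArcType {u} {v} (suc _ , q∈I , tw) = sym (cong proj₁ τ≡) , subst (I ∘ suc) (cong proj₂ τ≡) q∈I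
      where τ≡ = TwoWay⇒≡τ tw

    IArcType⇒IArc : ∀ {u v} → IArcType (τ u v) → IArc u v
    IArcType⇒IArc {u} {v} (δuv≡1 , i) = suc (δ v u) , i , ≡τ⇒TwoWay (cong (_, δ v u) (sym δuv≡1))

    IArc⇒A : ∀ {u v} → IArc u v → A u v ≡ true
    IArc⇒A (_ , _ , (step _ uv (here _) , _) , _) = uv

    IArcType⇒∼ : ∀ {u v} → IArcType (τ u v) → u ∼ v
    IArcType⇒∼ {u} {v} (δuv≡1 , i) = subst F (cong (_, δ v u) (sym δuv≡1)) (gen (suc (δ v u) , i , refl))

    IArcType⇒I : ∀ {t e} → IArcType t → t ≡ (1 , e) → I (suc e)
    IArcType⇒I (_ , i) refl = i

    ¬IArcType-refl : ∀ u → ¬ IArcType (τ u u)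
    ¬IArcType-refl u (δuu≡1 , _) with trans (sym δuu≡1) (cong proj₁ (τ-refl u))
    ... | ()

    semicomplete-everywhere : ∀ {x₀} → Semicomplete (Δ A I x₀) →
                              ∀ {u v} → u ∼ v → u ≢ v → IArcType (τ u v) ⊎ IArcType (τ v u)
    semicomplete-everywhere {x₀} semi {u} {v} u∼v u≢v with τ-transfer u x₀ v
    ... | z , τx₀z≡τuv = Sum.map (subst IArcType τx₀z≡τuv ∘ IArc⇒IArcType ∘ proj₂ ∘ proj₂)
                                 (subst IArcType (cong swap τx₀z≡τuv) ∘ IArc⇒IArcType ∘ proj₂ ∘ proj₂)
                                 (semi x₀ z (∼⇒FIx (∼-refl x₀)) (∼⇒FIx (subst F (sym τx₀z≡τuv) u∼v)) x₀≢z)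
      where
      x₀≢z : x₀ ≢ z
      x₀≢z refl = u≢v (δ≡0⇒≡ (cong proj₁ (trans (sym τx₀z≡τuv) (τ-refl x₀))))

    module SemicompleteClasses
      (semicomplete : ∀ {u v} → u ∼ v → u ≢ v → IArcType (τ u v) ⊎ IArcType (τ v u)) where

      -- I need not be decidable, so the counting argument runs under a double negation, which the
      -- decidable conclusion absorbs. Below a bound N on all distances I is ¬¬-decidable, and there
      -- the bounded predicate IArcType t × proj₂ t < N agrees with IArcType on every realised type.
      reverse-arc-δ≤2 : ∀ {u v} → u ∼ v → IArcType (τ v u) → δ u v ≤ 2
      reverse-arc-δ≤2 {u} {v} u∼v Ivu = decidable-stable (δ u v ≤? 2) λ δ≰2 →
        ¬¬-decidable-below (suc N) λ I? →
          δ≰2 (2-path⇒δ≤2 (τ-2-path (IArcType<N? I?) (Ivu , δ<N u v) (λ { ((() , _) , _) }) (escape δ≰2)))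
        where
        N = proj₁ (Fin-bounded₂ δ)
        δ<N = proj₂ (Fin-bounded₂ δ)

        IArcType<N? : (∀ m → m < suc N → Dec (I m)) → Decidable (λ t → IArcType t × proj₂ t < N)
        IArcType<N? I? (d , e) with e <? N
        ... | no  e≮N = no (e≮N ∘ proj₂)
        ... | yes e<N = Dec.map′ (_, e<N) proj₁ ((d ≟ 1) ×-dec I? (suc e) (s≤s e<N))

        escape : ¬ δ u v ≤ 2 → ∀ {z} → IArcType (τ u z) × δ z u < N → ¬ (IArcType (τ z v) × δ v z < N) →
                 ¬ ¬ (IArcType (τ v z) × δ z v < N)
        escape δ≰2 {z} (Iuz , _) ¬Izv ¬Ivz with z ≟ᶠ v
        ... | yes refl = δ≰2 (≤-trans (≤-reflexive (proj₁ Iuz)) (s≤s z≤n))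
        ... | no z≢v = [ ¬Izv ∘ (_, δ<N v z) , ¬Ivz ∘ (_, δ<N z v) ]′ (semicomplete (∼-comp (IArcType⇒∼ Iuz) u∼v) z≢v)

        2-path⇒δ≤2 : ∃[ z ] ((IArcType (τ u z) × δ z u < N) × (IArcType (τ z v) × δ v z < N)) → δ u v ≤ 2
        2-path⇒δ≤2 (z , ((δuz≡1 , _) , _) , ((δzv≡1 , _) , _)) = begin
          δ u v         ≤⟨ δ-triangle u z v ⟩
          δ u z + δ z v ≡⟨ cong₂ _+_ δuz≡1 δzv≡1 ⟩
          2             ∎
          where open ≤-Reasoning

      IArcType⇒ShortArcType : ∀ {u v} → u ∼ v → IArcType (τ u v) → ShortArcType (τ u v)
      IArcType⇒ShortArcType {u} {v} u∼v Iuv@(δuv≡1 , _) = short (δ v u) refl (reverse-arc-δ≤2 (∼-sym u∼v) Iuv)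
        where
        short : ∀ e → δ v u ≡ e → e ≤ 2 → ShortArcType (τ u v)
        short 0 δvu≡0 _ with δ≡0⇒≡ δvu≡0
        ... | refl = contradiction Iuv (¬IArcType-refl u)
        short 1 δvu≡1 _ = inj₁ (cong₂ _,_ δuv≡1 δvu≡1)
        short 2 δvu≡2 _ = inj₂ (cong₂ _,_ δuv≡1 δvu≡2)
        short (suc (suc (suc _))) _ (s≤s (s≤s ()))

      ShortArcType⇒IArcType : I 2 → I 3 → ∀ {t} → ShortArcType t → IArcType t
      ShortArcType⇒IArcType 2∈I _   (inj₁ refl) = refl , 2∈I
      ShortArcType⇒IArcType _   3∈I (inj₂ refl) = refl , 3∈I

      CycleType⇒∼ : I 3 → ∀ {x y} → CycleType (τ x y) → x ∼ y
      CycleType⇒∼ _   (inj₁ τxy≡0,0)        = subst F (sym τxy≡0,0) F-zero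
      CycleType⇒∼ 3∈I (inj₂ (inj₁ τxy≡1,2)) = subst F (sym τxy≡1,2) (gen (3 , 3∈I , refl))
      CycleType⇒∼ 3∈I (inj₂ (inj₂ τxy≡2,1)) = ∼-sym (CycleType⇒∼ 3∈I (inj₂ (inj₁ (cong swap τxy≡2,1))))

      2∈I⊎CycleType : ∀ {a b} → a ∼ b → I 2 ⊎ CycleType (τ a b)
      2∈I⊎CycleType {a} {b} a∼b with a ≟ᶠ b
      ... | yes refl = inj₂ (inj₁ (τ-refl a))
      ... | no a≢b with semicomplete a∼b a≢b
      ...   | inj₁ Iab = Sum.map (IArcType⇒I Iab) (inj₂ ∘ inj₁) (IArcType⇒ShortArcType a∼b Iab)
      ...   | inj₂ Iba = Sum.map (IArcType⇒I Iba) (inj₂ ∘ inj₂ ∘ cong swap) (IArcType⇒ShortArcType (∼-sym a∼b) Iba)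

      -- A decidable substitute for the question whether 2 ∈ I: if the cycle types are closed, arcs of
      -- type (1,2) alone yield the triangles; otherwise some class contains a pair of type (1,1),
      -- which semicompleteness turns into an I-arc.
      closed⊎2∈I : I 3 → CycleTypes-closed ⊎ I 2
      closed⊎2∈I 3∈I with any? (λ c → any? (λ a → any? (λ b →
                            CycleType? (τ c a) ×-dec CycleType? (τ c b) ×-dec ¬? (CycleType? (τ a b)))))
      ... | no ∄ = inj₁ λ c a b ca cb → decidable-stable (CycleType? (τ a b)) λ ¬ab → ∄ (c , a , b , ca , cb , ¬ab)
      ... | yes (c , a , b , ca , cb , ¬ab) =
        inj₂ ([ id , flip contradiction ¬ab ]′ (2∈I⊎CycleType (∼-comp (CycleType⇒∼ 3∈I ca) (CycleType⇒∼ 3∈I cb))))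

      2-path-if-2∈I : I 2 → I 3 → ∀ {u v} → u ∼ v → τ v u ≡ (1 , 2) →
                      ∃[ z ] (ShortArcType (τ u z) × ShortArcType (τ z v))
      2-path-if-2∈I 2∈I 3∈I {u} {v} u∼v τvu≡1,2 =
        τ-2-path ShortArcType? (inj₂ τvu≡1,2) (λ { (inj₁ ()) ; (inj₂ ()) }) escape
        where
        escape : ∀ {z} → ShortArcType (τ u z) → ¬ ShortArcType (τ z v) → ¬ ¬ ShortArcType (τ v z)
        escape {z} Suz ¬Szv ¬Svz with z ≟ᶠ v
        ... | yes refl = ¬ShortArcType-2,1 (cong swap τvu≡1,2) Suz
        ... | no z≢v = [ ¬Szv ∘ IArcType⇒ShortArcType z∼v , ¬Svz ∘ IArcType⇒ShortArcType (∼-sym z∼v) ]′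
                         (semicomplete z∼v z≢v)
          where z∼v = ∼-comp (IArcType⇒∼ (ShortArcType⇒IArcType 2∈I 3∈I Suz)) u∼v

      reverse-arc⇒2-path : ∀ {u v} → u ∼ v → IArcType (τ v u) → δ u v ≡ 2 →
                           ∃[ z ] (IArcType (τ u z) × IArcType (τ z v))
      reverse-arc⇒2-path {u} {v} u∼v Ivu δuv≡2 = [ from-closed , from-2∈I ]′ (closed⊎2∈I 3∈I)
        where
        τvu≡1,2 : τ v u ≡ (1 , 2)
        τvu≡1,2 = cong₂ _,_ (proj₁ Ivu) δuv≡2
        3∈I : I 3
        3∈I = IArcType⇒I Ivu τvu≡1,2
        from-closed : CycleTypes-closed → ∃[ z ] (IArcType (τ u z) × IArcType (τ z v))
        from-closed closed with 2-path-if-closed closed τvu≡1,2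
        ... | z , τuz≡1,2 , τzv≡1,2 =
          z , subst IArcType (sym τuz≡1,2) (refl , 3∈I) , subst IArcType (sym τzv≡1,2) (refl , 3∈I)
        from-2∈I : I 2 → ∃[ z ] (IArcType (τ u z) × IArcType (τ z v))
        from-2∈I 2∈I with 2-path-if-2∈I 2∈I 3∈I u∼v τvu≡1,2
        ... | z , Suz , Szv = z , ShortArcType⇒IArcType 2∈I 3∈I Suz , ShortArcType⇒IArcType 2∈I 3∈I Szv

      Δ-arc : ∀ {y u v} → y ∼ u → y ∼ v → IArcType (τ u v) → Digraph.Arc (Δ A I y) u v
      Δ-arc y∼u y∼v Iuv = ∼⇒FIx y∼u , ∼⇒FIx y∼v , IArcType⇒IArc Iuv

      Δ-arc-walk : ∀ {y u v} → y ∼ u → y ∼ v → IArcType (τ u v) → Walk (Δ A I y) u v (δ u v)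
      Δ-arc-walk {y} {u} {v} y∼u y∼v Iuv =
        subst (Walk (Δ A I y) u v) (sym (proj₁ Iuv)) (step (∼⇒FIx y∼u) (Δ-arc y∼u y∼v Iuv) (here (∼⇒FIx y∼v)))

      Δ-reverse-arc-walk : ∀ {y u v} → y ∼ u → y ∼ v → IArcType (τ v u) → Walk (Δ A I y) u v (δ u v)
      Δ-reverse-arc-walk {y} {u} {v} y∼u y∼v Ivu =
        [ via-arc , via-2-path ]′ (IArcType⇒ShortArcType (∼-comp y∼v y∼u) Ivu)
        where
        via-arc : τ v u ≡ (1 , 1) → Walk (Δ A I y) u v (δ u v)
        via-arc τvu≡1,1 =
          Δ-arc-walk y∼u y∼v (subst IArcType (sym (cong swap τvu≡1,1)) (refl , IArcType⇒I Ivu τvu≡1,1))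

        via-2-path : τ v u ≡ (1 , 2) → Walk (Δ A I y) u v (δ u v)
        via-2-path τvu≡1,2 with reverse-arc⇒2-path (∼-comp y∼u y∼v) Ivu (cong proj₂ τvu≡1,2)
        ... | z , Iuz , Izv = subst (Walk (Δ A I y) u v) (sym (cong proj₂ τvu≡1,2))
          (step (∼⇒FIx y∼u) (Δ-arc y∼u y∼z Iuz) (step (∼⇒FIx y∼z) (Δ-arc y∼z y∼v Izv) (here (∼⇒FIx y∼v))))
          where y∼z = ∼-trans y∼u (IArcType⇒∼ Iuz)

      Δ-walk : ∀ {y u v} → y ∼ u → y ∼ v → Walk (Δ A I y) u v (δ u v)
      Δ-walk {y} {u} {v} y∼u y∼v with u ≟ᶠ v
      ... | yes refl = subst (Walk (Δ A I y) u u) (sym (cong proj₁ (τ-refl u))) (here (∼⇒FIx y∼u))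
      ... | no u≢v   = [ Δ-arc-walk y∼u y∼v , Δ-reverse-arc-walk y∼u y∼v ]′ (semicomplete (∼-comp y∼u y∼v) u≢v)

      Δ-walk⇒Γ-walk : ∀ {y u v k} → Walk (Δ A I y) u v k → Walk Γ u v k
      Δ-walk⇒Γ-walk (here _)               = here tt
      Δ-walk⇒Γ-walk (step _ (_ , _ , arc) w) = step tt (IArc⇒A arc) (Δ-walk⇒Γ-walk w)

      Δ-Dist : ∀ {y u v} → y ∼ u → y ∼ v → Dist (Δ A I y) u v (δ u v)
      Δ-Dist {u = u} {v} y∼u y∼v =
        Δ-walk y∼u y∼v , λ m m<δ w → proj₂ (proj₂ (distance u v)) m m<δ (Δ-walk⇒Γ-walk w)

      Δ-TwoWay : ∀ {y u v} → y ∼ u → y ∼ v → TwoWay (Δ A I y) u v (τ u v)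
      Δ-TwoWay y∼u y∼v = Δ-Dist y∼u y∼v , Δ-Dist y∼v y∼u

      Δ-TwoWay⁻ : ∀ {y u v h} → TwoWay (Δ A I y) u v h → y ∼ u × y ∼ v × h ≡ τ u v
      Δ-TwoWay⁻ tw with walk-endpoints (proj₁ (proj₁ tw))
      ... | y∼u , y∼v = FIx⇒∼ y∼u , FIx⇒∼ y∼v , TwoWay-functional tw (Δ-TwoWay (FIx⇒∼ y∼u) (FIx⇒∼ y∼v))

      Δ⇒Γ-TwoWay : ∀ {y u v h} → TwoWay (Δ A I y) u v h → TwoWay Γ u v h
      Δ⇒Γ-TwoWay tw = ≡τ⇒TwoWay (proj₂ (proj₂ (Δ-TwoWay⁻ tw)))

      Γ⇒Δ-TwoWay : ∀ {y u v h} → y ∼ u → y ∼ v → TwoWay Γ u v h → TwoWay (Δ A I y) u v h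
      Γ⇒Δ-TwoWay {y} {u} {v} y∼u y∼v tw = subst (TwoWay (Δ A I y) u v) (sym (TwoWay⇒≡τ tw)) (Δ-TwoWay y∼u y∼v)

      Δ-InVals⇒F : ∀ {y i} → InVals (Δ A I y) i → F i
      Δ-InVals⇒F (u , v , tw) with Δ-TwoWay⁻ tw
      ... | y∼u , y∼v , refl = ∼-comp y∼u y∼v

      Δ-InVals⇒Γ-InVals : ∀ {y i} → InVals (Δ A I y) i → InVals Γ i
      Δ-InVals⇒Γ-InVals (u , v , tw) = u , v , Δ⇒Γ-TwoWay tw

      Num-Δ⇔Num-Γ : ∀ {y a b i j m} → y ∼ a → y ∼ b → F i → Num (Δ A I y) a b i j m ⇔ Num Γ a b i j m
      Num-Δ⇔Num-Γ {y} {a} {b} {i} {j} y∼a y∼b Fi =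
        mk⇔ (Count-map {G = Δ A I y} {H = Γ} Δ⇒Γ Γ⇒Δ) (Count-map {G = Γ} {H = Δ A I y} Γ⇒Δ Δ⇒Γ)
        where
        Δ⇒Γ : ∀ {z} → FIx A I y z × TwoWay (Δ A I y) a z i × TwoWay (Δ A I y) z b j →
                      ⊤ × TwoWay Γ a z i × TwoWay Γ z b j
        Δ⇒Γ (_ , az , zb) = tt , Δ⇒Γ-TwoWay az , Δ⇒Γ-TwoWay zb
        Γ⇒Δ : ∀ {z} → ⊤ × TwoWay Γ a z i × TwoWay Γ z b j →
                      FIx A I y z × TwoWay (Δ A I y) a z i × TwoWay (Δ A I y) z b j
        Γ⇒Δ (_ , az , zb) = ∼⇒FIx y∼z , Γ⇒Δ-TwoWay y∼a y∼z az , Γ⇒Δ-TwoWay y∼z y∼b zb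
          where y∼z = ∼-trans y∼a (subst F (TwoWay⇒≡τ az) Fi)

      Δ-WDR : ∀ y → WDR (Δ A I y)
      Δ-WDR y = (λ u v y∼u y∼v → δ u v , Δ-walk (FIx⇒∼ y∼u) (FIx⇒∼ y∼v)) , params
        where
        params : ∀ h i j → InVals (Δ A I y) h → InVals (Δ A I y) i → InVals (Δ A I y) j →
                 ∃[ p ] (∀ a b → TwoWay (Δ A I y) a b h → Num (Δ A I y) a b i j p)
        params h i j Vh Vi Vj
          with proj₂ wdr h i j (Δ-InVals⇒Γ-InVals Vh) (Δ-InVals⇒Γ-InVals Vi) (Δ-InVals⇒Γ-InVals Vj)
        ... | p , num = p , λ a b tw → let y∼a , y∼b , _ = Δ-TwoWay⁻ tw in
          Equivalence.from (Num-Δ⇔Num-Γ y∼a y∼b (Δ-InVals⇒F Vi)) (num a b (Δ⇒Γ-TwoWay tw))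

      Num-Δ-suc⇒InVals : ∀ {y a b i j k} → Num (Δ A I y) a b i j (suc k) →
                         InVals (Δ A I y) i × InVals (Δ A I y) j
      Num-Δ-suc⇒InVals {y} {a} {b} c with Count-witness {G = Δ A I y} c
      ... | z , _ , az , zb = (a , z , az) , (z , b , zb)

      Num-Δ≡ : ∀ {y y′ y″ h i j a b u v m m′} → InVals (Δ A I y″) i × InVals (Δ A I y″) j →
               TwoWay (Δ A I y) a b h → TwoWay (Δ A I y′) u v h →
               Num (Δ A I y) a b i j m → Num (Δ A I y′) u v i j m′ → m ≡ m′
      Num-Δ≡ {i = i} {j} {a} {b} {u} {v} (Vi , Vj) ab uv c c′
        with proj₂ wdr _ _ _ (a , b , Δ⇒Γ-TwoWay ab) (Δ-InVals⇒Γ-InVals Vi) (Δ-InVals⇒Γ-InVals Vj)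
      ... | p , num = trans (Count-functional {G = Γ} (to-Γ ab c) (num a b (Δ⇒Γ-TwoWay ab)))
                            (sym (Count-functional {G = Γ} (to-Γ uv c′) (num u v (Δ⇒Γ-TwoWay uv))))
        where
        to-Γ : ∀ {y a b h m} → TwoWay (Δ A I y) a b h → Num (Δ A I y) a b i j m → Num Γ a b i j m
        to-Γ tw = let y∼a , y∼b , _ = Δ-TwoWay⁻ tw in Equivalence.to (Num-Δ⇔Num-Γ y∼a y∼b (Δ-InVals⇒F Vi))

      Δ-SameParams : ∀ y y′ → SameParams (Δ A I y) (Δ A I y′)
      Δ-SameParams y y′ h i j a b u v ab uv zero    zero    c c′ = refl
      Δ-SameParams y y′ h i j a b u v ab uv (suc _) _       c c′ = Num-Δ≡ (Num-Δ-suc⇒InVals c) ab uv c c′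
      Δ-SameParams y y′ h i j a b u v ab uv zero    (suc _) c c′ = Num-Δ≡ (Num-Δ-suc⇒InVals c′) ab uv c c′

lemma2p4 : ∀ {n} (A : Fin n → Fin n → Bool) → (∀ x → A x x ≡ false) →
    WDR (Γd A) → (I : ℕ → Set) → ∃ I → (∀ q → I q → InT A q) →
    (x : Fin n) → Semicomplete (Δ A I x) →
    (∀ y → WDR (Δ A I y)) × (∀ y → SameParams (Δ A I x) (Δ A I y))
lemma2p4 A _ wdr I (_ , q₀∈I) I⊆T x semi = Δ-WDR , Δ-SameParams x
  where
  open WeaklyDistanceRegular A wdr
  open Classes I q₀∈I I⊆T
  open SemicompleteClasses (semicomplete-everywhere semi)
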